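{- Let $\mathcal{A}$ be a tense distributive lattice and $\mathbf{X}=(X,\le,R)$ a $\mathbf{tDL}$-frame. Then: (1) the canonical frame $\mathfrak{M}(\mathcal{A})$ is a $\mathbf{tDL}$-frame; (2) the complex algebra $\mathfrak{C}(\mathbf{X})$ is a tense distributive lattice; (3) the map $h_A:\mathcal{A}\to\mathfrak{C}(\mathfrak{M}(\mathcal{A}))$, $h_A(a)=\{T\in X(A):a\in T\}$, is an embedding of tense distributive lattices, and if $\mathcal{A}$ is finite then $h_A$ is an isomorphism; (4) the map $k_X:\mathbf{X}\to\mathfrak{M}(\mathfrak{C}(\mathbf{X}))$, $k_X(x)=\{U\in\mathcal{P}_i(X):x\in U\}$, is an embedding of $\mathbf{tDL}$-frames, and if $X$ is finite then $k_X$ is an isomorphism.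
   Context: A tense distributive lattice ($\mathbf{tDL}$-algebra) is a bounded distributive lattice $\langle A,\wedge,\vee,0,1\rangle$ with unary operators $\mathbf{G},\mathbf{H},\mathbf{F},\mathbf{P}$ such that for all $x,y$: $\mathbf{G}1=\mathbf{H}1=1$; $\mathbf{G},\mathbf{H}$ preserve $\wedge$; $x\le\mathbf{G}\mathbf{P}x$, $x\le\mathbf{H}\mathbf{F}x$; $\mathbf{G}(x\vee y)\le\mathbf{G}x\vee\mathbf{F}y$, $\mathbf{H}(x\vee y)\le\mathbf{H}x\vee\mathbf{P}y$; $\mathbf{F}0=\mathbf{P}0=0$; $\mathbf{F},\mathbf{P}$ preserve $\vee$; $\mathbf{P}\mathbf{G}x\le x$, $\mathbf{F}\mathbf{H}x\le x$; $\mathbf{G}x\wedge\mathbf{F}y\le\mathbf{F}(x\wedge y)$, $\mathbf{H}x\wedge\mathbf{P}y\le\mathbf{P}(x\wedge y)$. An embedding of such algebras is an injective homomorphism (preserving lattice operations, bounds and the four operators). For a relation $R$ on $X$: $R(x)=\{y:(x,y)\in R\}$, $R^{ -1}(x)=\{y:(y,x)\in R\}$, $R(Y)=\bigcup_{y\in Y}R(y)$, similarly $R^{ -1}(Y)$; ${\uparrow},{\downarrow}$ denote up- and down-closures in $(X,\le)$. A $\mathbf{tDL}$-frame is $(X,\le,R)$ with $(X,\le)$ a poset such that for all $x$: (K1) $R({\uparrow}x)\subseteq{\uparrow}R(x)$; (K2) $R^{ -1}({\uparrow}x)\subseteq{\uparrow}R^{ -1}(x)$; (K3) $R({\downarrow}x)\subseteq{\downarrow}R(x)$;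 (K4) $R^{ -1}({\downarrow}x)\subseteq{\downarrow}R^{ -1}(x)$; (K5) $R(x)={\uparrow}R(x)\cap{\downarrow}R(x)$. $\mathcal{P}_i(X)$ is the set of up-sets of $(X,\le)$. The complex algebra is $\mathfrak{C}(\mathbf{X})=\langle\mathcal{P}_i(X),\cap,\cup,\emptyset,X,\mathbf{G}_R,\mathbf{H}_{R^{ -1}},\mathbf{F}_R,\mathbf{P}_{R^{ -1}}\rangle$ with $\mathbf{G}_R(Y)=\{x:R(x)\subseteq Y\}$, $\mathbf{F}_R(Y)=\{x:R(x)\cap Y\ne\emptyset\}$, $\mathbf{H}_{R^{ -1}}(Y)=\{x:R^{ -1}(x)\subseteq Y\}$, $\mathbf{P}_{R^{ -1}}(Y)=\{x:R^{ -1}(x)\cap Y\ne\emptyset\}$. The canonical frame of $\mathcal{A}$ is $\mathfrak{M}(\mathcal{A})=(X(A),\subseteq,R_A)$ where $X(A)$ is the set of prime filters of $A$ and $(S,T)\in R_A$ iff $\{a:\mathbf{G}a\in S\}\subseteq T\subseteq\{a:\mathbf{F}a\in S\}$. An embedding of $\mathbf{tDL}$-frames $f:(X,\le,R)\to(X',\le',R')$ is a map with $x\le y\iff f(x)\le' f(y)$ and $(x,y)\in R\iff(f(x),f(y))\in R'$; an isomorphism is a bijective embedding. -}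

module Defs where

open import Level using (Level; _⊔_; suc; Lift; lift; lower; Setω)
open import Data.Empty using (⊥)
open import Data.Unit using (⊤; tt)
open import Data.Nat using (ℕ)
open import Data.Fin using (Fin)
open import Data.Product using (Σ; ∃; _×_; _,_; proj₁; proj₂)
open import Data.Sum using (_⊎_; inj₁; inj₂)
open import Relation.Nullary using (¬_)
open import Relation.Unary using (Pred; _∈_; _⊆_; _≐_; _∩_)
open import Relation.Binary using (Rel; IsPartialOrder)
open import Algebra.Core using (Op₁; Op₂)
open import Algebra.Definitions using (Congruent₁)
open import Algebra.Lattice.Structures using (IsDistributiveLattice)
open import Function.Bundles using (_⇔_)
open import Axiom.ExcludedMiddle using (ExcludedMiddle)

LEM : Setω
LEM = ∀ {ℓ} → ExcludedMiddle ℓ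

module _ {c ℓ : Level} {A : Set c} (_≈_ : Rel A ℓ) (_∧_ _∨_ : Op₂ A) (𝟘 𝟙 : A) where

  _≤ᴸ_ : Rel A ℓ
  x ≤ᴸ y = (x ∧ y) ≈ x

  record IsBDL : Set (c ⊔ ℓ) where
    field
      isDistributiveLattice : IsDistributiveLattice _≈_ _∨_ _∧_
      ∨-identityʳ : ∀ x → (x ∨ 𝟘) ≈ x
      ∧-identityʳ : ∀ x → (x ∧ 𝟙) ≈ x

  record IsFilter {p : Level} (S : Pred A p) : Set (c ⊔ ℓ ⊔ p) where
    field
      𝟙∈ : 𝟙 ∈ S
      ∧-closed : ∀ x y → x ∈ S → y ∈ S → (x ∧ y) ∈ S
      up-closed : ∀ x y → x ∈ S → x ≤ᴸ y → y ∈ S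

  record IsIdeal {p : Level} (I : Pred A p) : Set (c ⊔ ℓ ⊔ p) where
    field
      𝟘∈ : 𝟘 ∈ I
      ∨-closed : ∀ x y → x ∈ I → y ∈ I → (x ∨ y) ∈ I
      down-closed : ∀ x y → x ∈ I → y ≤ᴸ x → y ∈ I

  record IsPrimeFilter {p : Level} (S : Pred A p) : Set (c ⊔ ℓ ⊔ p) where
    field
      isFilter : IsFilter S
      proper : ¬ (𝟘 ∈ S)
      prime : ∀ x y → (x ∨ y) ∈ S → x ∈ S ⊎ y ∈ S

Disjoint : ∀ {a p q} {A : Set a} → Pred A p → Pred A q → Set (a ⊔ p ⊔ q)
Disjoint P Q = ∀ x → x ∈ P → x ∈ Q → ⊥

-- The prime filter theorem (a consequence of the axiom of choice) for
-- bounded distributive lattices: a filter disjoint from an ideal extends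
-- to a prime filter disjoint from that ideal.
PrimeFilterTheorem : Setω
PrimeFilterTheorem =
  ∀ {c ℓ} {A : Set c} (_≈_ : Rel A ℓ) (_∧_ _∨_ : Op₂ A) (𝟘 𝟙 : A) →
  IsBDL _≈_ _∧_ _∨_ 𝟘 𝟙 →
  (Φ Ι : Pred A (c ⊔ ℓ)) →
  IsFilter _≈_ _∧_ _∨_ 𝟘 𝟙 Φ → IsIdeal _≈_ _∧_ _∨_ 𝟘 𝟙 Ι → Disjoint Φ Ι →
  Σ (Pred A (c ⊔ ℓ)) λ Π →
    IsPrimeFilter _≈_ _∧_ _∨_ 𝟘 𝟙 Π × Φ ⊆ Π × Disjoint Π Ι

Finite : ∀ {c ℓ} {A : Set c} → Rel A ℓ → Set (c ⊔ ℓ)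
Finite {A = A} _≈_ = Σ ℕ λ n → Σ (Fin n → A) λ e → ∀ a → ∃ λ i → e i ≈ a

record TDLRaw (c ℓ : Level) : Set (suc (c ⊔ ℓ)) where
  infix 4 _≈_ _≤_
  infixr 7 _∧_
  infixr 6 _∨_
  field
    Carrier : Set c
    _≈_ : Rel Carrier ℓ
    _∧_ _∨_ : Op₂ Carrier
    𝟘 𝟙 : Carrier
    G H F P : Op₁ Carrier

  _≤_ : Rel Carrier ℓ
  _≤_ = _≤ᴸ_ _≈_ _∧_ _∨_ 𝟘 𝟙

record IsTDL {c ℓ} (𝒜 : TDLRaw c ℓ) : Set (c ⊔ ℓ) where
  open TDLRaw 𝒜
  field
    isBDL : IsBDL _≈_ _∧_ _∨_ 𝟘 𝟙
    G-cong : Congruent₁ _≈_ G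
    H-cong : Congruent₁ _≈_ H
    F-cong : Congruent₁ _≈_ F
    P-cong : Congruent₁ _≈_ P
    G𝟙 : G 𝟙 ≈ 𝟙
    H𝟙 : H 𝟙 ≈ 𝟙
    G-∧ : ∀ x y → G (x ∧ y) ≈ G x ∧ G y
    H-∧ : ∀ x y → H (x ∧ y) ≈ H x ∧ H y
    x≤GPx : ∀ x → x ≤ G (P x)
    x≤HFx : ∀ x → x ≤ H (F x)
    G-∨ : ∀ x y → G (x ∨ y) ≤ G x ∨ F y
    H-∨ : ∀ x y → H (x ∨ y) ≤ H x ∨ P y
    F𝟘 : F 𝟘 ≈ 𝟘
    P𝟘 : P 𝟘 ≈ 𝟘
    F-∨ : ∀ x y → F (x ∨ y) ≈ F x ∨ F y
    P-∨ : ∀ x y → P (x ∨ y) ≈ P x ∨ P y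
    PGx≤x : ∀ x → P (G x) ≤ x
    FHx≤x : ∀ x → F (H x) ≤ x
    G∧F : ∀ x y → G x ∧ F y ≤ F (x ∧ y)
    H∧P : ∀ x y → H x ∧ P y ≤ P (x ∧ y)

module _ {c₁ ℓ₁ c₂ ℓ₂} (𝒜 : TDLRaw c₁ ℓ₁) (ℬ : TDLRaw c₂ ℓ₂) where
  private
    module A = TDLRaw 𝒜
    module B = TDLRaw ℬ

  record IsTDLHomomorphism (f : A.Carrier → B.Carrier) : Set (c₁ ⊔ ℓ₁ ⊔ ℓ₂) where
    field
      cong : ∀ {x y} → x A.≈ y → f x B.≈ f y
      ∧-homo : ∀ x y → f (x A.∧ y) B.≈ f x B.∧ f y
      ∨-homo : ∀ x y → f (x A.∨ y) B.≈ f x B.∨ f y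
      𝟘-homo : f A.𝟘 B.≈ B.𝟘
      𝟙-homo : f A.𝟙 B.≈ B.𝟙
      G-homo : ∀ x → f (A.G x) B.≈ B.G (f x)
      H-homo : ∀ x → f (A.H x) B.≈ B.H (f x)
      F-homo : ∀ x → f (A.F x) B.≈ B.F (f x)
      P-homo : ∀ x → f (A.P x) B.≈ B.P (f x)

  record IsTDLEmbedding (f : A.Carrier → B.Carrier) : Set (c₁ ⊔ ℓ₁ ⊔ ℓ₂) where
    field
      isHomomorphism : IsTDLHomomorphism f
      injective : ∀ {x y} → f x B.≈ f y → x A.≈ y

  record IsTDLIsomorphism (f : A.Carrier → B.Carrier) : Set (c₁ ⊔ ℓ₁ ⊔ c₂ ⊔ ℓ₂) where
    field
      isEmbedding : IsTDLEmbedding f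
      surjective : ∀ y → ∃ λ x → f x B.≈ y

record FrameRaw (x e r ρ : Level) : Set (suc (x ⊔ e ⊔ r ⊔ ρ)) where
  infix 4 _≈_ _≤_
  field
    Carrier : Set x
    _≈_ : Rel Carrier e
    _≤_ : Rel Carrier r
    R : Rel Carrier ρ

  R⟨_⟩ : Carrier → Pred Carrier ρ
  R⟨ a ⟩ b = R a b

  R⁻¹⟨_⟩ : Carrier → Pred Carrier ρ
  R⁻¹⟨ a ⟩ b = R b a

  R[_] : ∀ {p} → Pred Carrier p → Pred Carrier (x ⊔ ρ ⊔ p)
  R[ Y ] b = ∃ λ a → a ∈ Y × R a b

  R⁻¹[_] : ∀ {p} → Pred Carrier p → Pred Carrier (x ⊔ ρ ⊔ p)
  R⁻¹[ Y ] b = ∃ λ a → a ∈ Y × R b a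

  ↑⟨_⟩ : Carrier → Pred Carrier r
  ↑⟨ a ⟩ b = a ≤ b

  ↓⟨_⟩ : Carrier → Pred Carrier r
  ↓⟨ a ⟩ b = b ≤ a

  ↑[_] : ∀ {p} → Pred Carrier p → Pred Carrier (x ⊔ r ⊔ p)
  ↑[ Y ] b = ∃ λ a → a ∈ Y × a ≤ b

  ↓[_] : ∀ {p} → Pred Carrier p → Pred Carrier (x ⊔ r ⊔ p)
  ↓[ Y ] b = ∃ λ a → a ∈ Y × b ≤ a

record IsTDLFrame {x e r ρ} (𝐗 : FrameRaw x e r ρ) : Set (x ⊔ e ⊔ r ⊔ ρ) where
  open FrameRaw 𝐗
  field
    isPartialOrder : IsPartialOrder _≈_ _≤_
    K1 : ∀ a → R[ ↑⟨ a ⟩ ] ⊆ ↑[ R⟨ a ⟩ ]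
    K2 : ∀ a → R⁻¹[ ↑⟨ a ⟩ ] ⊆ ↑[ R⁻¹⟨ a ⟩ ]
    K3 : ∀ a → R[ ↓⟨ a ⟩ ] ⊆ ↓[ R⟨ a ⟩ ]
    K4 : ∀ a → R⁻¹[ ↓⟨ a ⟩ ] ⊆ ↓[ R⁻¹⟨ a ⟩ ]
    K5 : ∀ a → R⟨ a ⟩ ≐ (↑[ R⟨ a ⟩ ] ∩ ↓[ R⟨ a ⟩ ])

module _ {x₁ e₁ r₁ ρ₁ x₂ e₂ r₂ ρ₂}
         (𝐗 : FrameRaw x₁ e₁ r₁ ρ₁) (𝐘 : FrameRaw x₂ e₂ r₂ ρ₂) where
  private
    module X = FrameRaw 𝐗
    module Y = FrameRaw 𝐘

  record IsFrameEmbedding (f : X.Carrier → Y.Carrier)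
      : Set (x₁ ⊔ r₁ ⊔ ρ₁ ⊔ r₂ ⊔ ρ₂) where
    field
      order-embedding : ∀ a b → (a X.≤ b) ⇔ (f a Y.≤ f b)
      relation-embedding : ∀ a b → X.R a b ⇔ Y.R (f a) (f b)

  record IsFrameIsomorphism (f : X.Carrier → Y.Carrier)
      : Set (x₁ ⊔ e₁ ⊔ r₁ ⊔ ρ₁ ⊔ x₂ ⊔ e₂ ⊔ r₂ ⊔ ρ₂) where
    field
      isEmbedding : IsFrameEmbedding f
      injective : ∀ {a b} → f a Y.≈ f b → a X.≈ b
      surjective : ∀ y → ∃ λ a → f a Y.≈ y

module _ {c ℓ} (𝒜 : TDLRaw c ℓ) where
  open TDLRaw 𝒜

  record PrimeFilter : Set (suc (c ⊔ ℓ)) where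
    field
      pf : Pred Carrier (c ⊔ ℓ)
      isPrimeFilter : IsPrimeFilter _≈_ _∧_ _∨_ 𝟘 𝟙 pf

  open PrimeFilter

  CanonicalFrame : FrameRaw (suc (c ⊔ ℓ)) (c ⊔ ℓ) (c ⊔ ℓ) (c ⊔ ℓ)
  CanonicalFrame = record
    { Carrier = PrimeFilter
    ; _≈_ = λ S T → pf S ≐ pf T
    ; _≤_ = λ S T → pf S ⊆ pf T
    ; R = λ S T → ((λ a → G a ∈ pf S) ⊆ pf T) × (pf T ⊆ (λ a → F a ∈ pf S))
    }

module _ {x e r ρ} (𝐗 : FrameRaw x e r ρ) where
  open FrameRaw 𝐗

  upℓ : Level
  upℓ = x ⊔ r ⊔ ρ

  record UpSet : Set (suc upℓ) where
    field
      set : Pred Carrier upℓ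
      up : ∀ {a b} → a ≤ b → a ∈ set → b ∈ set

open UpSet public

module _ {x e r ρ} (𝐗 : FrameRaw x e r ρ) (isF : IsTDLFrame 𝐗) where
  open FrameRaw 𝐗
  open IsTDLFrame isF

  private
    U : Set _
    U = UpSet 𝐗

    _∩ᵘ_ : U → U → U
    A ∩ᵘ B = record { set = set A ∩ set B
                    ; up = λ le p → up A le (proj₁ p) , up B le (proj₂ p) }

    _∪ᵘ_ : U → U → U
    A ∪ᵘ B = record { set = λ a → a ∈ set A ⊎ a ∈ set B
                    ; up = λ { le (inj₁ p) → inj₁ (up A le p)
                             ; le (inj₂ p) → inj₂ (up B le p) } }

    ∅ᵘ : U
    ∅ᵘ = record { set = λ _ → Lift (upℓ 𝐗) ⊥ ; up = λ _ p → p }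

    Xᵘ : U
    Xᵘ = record { set = λ _ → Lift (upℓ 𝐗) ⊤ ; up = λ _ p → p }

    𝐆 : U → U
    𝐆 Y = record
      { set = λ a → ∀ b → R a b → b ∈ set Y
      ; up = λ {a} {a′} le h b Ra′b →
          let (w , Raw , w≤b) = K1 a (a′ , le , Ra′b)
          in up Y w≤b (h w Raw) }

    𝐇 : U → U
    𝐇 Y = record
      { set = λ a → ∀ b → R b a → b ∈ set Y
      ; up = λ {a} {a′} le h b Rba′ →
          let (w , Rwa , w≤b) = K2 a (a′ , le , Rba′)
          in up Y w≤b (h w Rwa) }

    𝐅 : U → U
    𝐅 Y = record
      { set = λ a → ∃ λ b → R a b × b ∈ set Y
      ; up = λ {a} {a′} le → λ { (b , Rab , bY) →
          let (w , Ra′w , b≤w) = K3 a′ (a , le , Rab)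
          in w , Ra′w , up Y b≤w bY } }

    𝐏 : U → U
    𝐏 Y = record
      { set = λ a → ∃ λ b → R b a × b ∈ set Y
      ; up = λ {a} {a′} le → λ { (b , Rba , bY) →
          let (w , Rwa′ , b≤w) = K4 a′ (a , le , Rba)
          in w , Rwa′ , up Y b≤w bY } }

  ComplexAlgebra : TDLRaw (suc (upℓ 𝐗)) (upℓ 𝐗)
  ComplexAlgebra = record
    { Carrier = U
    ; _≈_ = λ A B → set A ≐ set B
    ; _∧_ = _∩ᵘ_
    ; _∨_ = _∪ᵘ_
    ; 𝟘 = ∅ᵘ
    ; 𝟙 = Xᵘ
    ; G = 𝐆
    ; H = 𝐇
    ; F = 𝐅
    ; P = 𝐏
    }

h : ∀ {c ℓ} (𝒜 : TDLRaw c ℓ) → TDLRaw.Carrier 𝒜 → UpSet (CanonicalFrame 𝒜)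
h 𝒜 a = record
  { set = λ T → Lift (suc _) (a ∈ PrimeFilter.pf T)
  ; up = λ S⊆T p → lift (S⊆T (lower p)) }

k : ∀ {x e r ρ} (𝐗 : FrameRaw x e r ρ) (isF : IsTDLFrame 𝐗) →
    FrameRaw.Carrier 𝐗 → PrimeFilter (ComplexAlgebra 𝐗 isF)
k 𝐗 isF a = record
  { pf = λ Y → Lift (suc (upℓ 𝐗)) (a ∈ set Y)
  ; isPrimeFilter = record
    { isFilter = record
      { 𝟙∈ = lift (lift tt)
      ; ∧-closed = λ Y Z p q → lift (lower p , lower q)
      ; up-closed = λ Y Z p Y≤Z → lift (proj₂ (proj₂ Y≤Z (lower p)))
      }
    ; proper = λ p → Level.lower (lower p)
    ; prime = λ Y Z p → Data.Sum.map lift lift (lower p)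
    }
  }
  where import Data.Sum

{-# OPTIONS --safe #-}
module Submission where

-- Successors in the canonical frame: a prime filter T is an R-successor of S
-- when G⁻¹S ⊆ T ⊆ F⁻¹S.  The prime filter theorem yields successors that
-- contain a given filter below F⁻¹S or avoid a given ideal disjoint from G⁻¹S,
-- whence G a ∈ S iff a lies in every successor of S and F a ∈ S iff a lies in
-- some successor.  These equivalences make h a homomorphism and give K1–K4;
-- the same argument for (H, P) applies because the adjunction laws make its
-- successor relation the converse of R.  Prime filters separate a from b when
-- a ≰ b, so h is injective.  Dually, the complex algebra is a sublattice of the
-- powerset with the box and diamond of R and of its converse, and R is read
-- back from the canonical relation on the filters k x through K5.  In the
-- finite case every prime filter is generated by one member of a finite
-- join-dense family (the elements of A, resp. the principal up-sets of X),
-- which gives surjectivity of h and k.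

open import Defs
open import Level using (Lift; lift; lower; _⊔_) renaming (suc to lsuc)
open import Data.Nat using (zero; suc)
open import Data.Fin using (Fin; zero; suc)
open import Data.Product using (∃; ∃₂; _×_; _,_; proj₁; proj₂)
open import Data.Sum using (_⊎_; inj₁; inj₂; [_,_]′)
import Data.Sum as Sum
import Data.Vec.Functional as Vector
open import Function using (_∘_; flip)
open import Function.Bundles using (_⇔_; mk⇔; Equivalence)
open import Relation.Nullary using (Dec; yes; no; contradiction)
open import Relation.Unary using (Pred; _∈_; _⊆_; _≐_; _∩_; _∪_; ∁)
open import Relation.Unary.Properties using (≐-refl)
open import Relation.Unary.Algebra
  using (∪-∩-isDistributiveLattice; ∪-identityʳ; ∩-identityʳ)
open import Relation.Unary.Relation.Binary.Subset using (⊆-isPartialOrder)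
open import Relation.Binary using (Rel; IsPartialOrder; IsEquivalence)
import Relation.Binary.Construct.On as On
import Relation.Binary.Lattice as Ord
import Relation.Binary.Lattice.Properties.JoinSemilattice as JoinSemilatticeProperties
import Relation.Binary.Lattice.Properties.MeetSemilattice as MeetSemilatticeProperties
open import Algebra.Core using (Op₁; Op₂)
open import Algebra.Definitions using (Congruent₁)
open import Algebra.Lattice.Structures using (IsDistributiveLattice)
import Algebra.Lattice.Bundles as Alg
import Algebra.Lattice.Properties.Lattice as AlgLatticeProperties
open import Algebra.Lattice.Morphism.Structures using (IsLatticeMonomorphism)
import Algebra.Lattice.Morphism.LatticeMonomorphism as LatticeMonomorphism
open import Axiom.DoubleNegationElimination using (em⇒dne)

module BoundedDistributiveLattice
    {c ℓ} {A : Set c} {_≈_ : Rel A ℓ} {_∧_ _∨_ : Op₂ A} {𝟘 𝟙 : A}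
    (bdl : IsBDL _≈_ _∧_ _∨_ 𝟘 𝟙) where

  open IsBDL bdl
  open IsDistributiveLattice isDistributiveLattice
    using (isLattice; isEquivalence)
  open IsEquivalence isEquivalence public using ()
    renaming (refl to ≈-refl; sym to ≈-sym; trans to ≈-trans)

  infix 4 _≤_
  _≤_ : Rel A ℓ
  _≤_ = _≤ᴸ_ _≈_ _∧_ _∨_ 𝟘 𝟙

  private
    algLattice : Alg.Lattice c ℓ
    algLattice = record { isLattice = isLattice }

    -- The library orders a lattice by x ≈ x ∧ y; ours is x ∧ y ≈ x.
    module Std = Ord.IsLattice
      (AlgLatticeProperties.∨-∧-isOrderTheoreticLattice algLattice)

  ≤-isLattice : Ord.IsLattice _≈_ _≤_ _∨_ _∧_
  ≤-isLattice = record
    { isPartialOrder = record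
      { isPreorder = record
        { isEquivalence = isEquivalence
        ; reflexive = ≈-sym ∘ Std.reflexive
        ; trans = λ p q → ≈-sym (Std.trans (≈-sym p) (≈-sym q))
        }
      ; antisym = λ p q → Std.antisym (≈-sym p) (≈-sym q)
      }
    ; supremum = λ x y → let (x≤ , y≤ , least) = Std.supremum x y
        in ≈-sym x≤ , ≈-sym y≤ , λ z p q → ≈-sym (least z (≈-sym p) (≈-sym q))
    ; infimum = λ x y → let (≤x , ≤y , greatest) = Std.infimum x y
        in ≈-sym ≤x , ≈-sym ≤y , λ z p q → ≈-sym (greatest z (≈-sym p) (≈-sym q))
    }

  ≤-lattice : Ord.Lattice c ℓ ℓ
  ≤-lattice = record { isLattice = ≤-isLattice }

  open Ord.IsLattice ≤-isLattice public
    using (reflexive; trans; antisym; x≤x∨y; y≤x∨y; ∨-least; x∧y≤x; x∧y≤y; ∧-greatest)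
    renaming (refl to ≤-refl)
  open JoinSemilatticeProperties (Ord.Lattice.joinSemilattice ≤-lattice) public
    using (∨-monotonic; x≤y⇒x∨y≈y)
  open MeetSemilatticeProperties (Ord.Lattice.meetSemilattice ≤-lattice) public
    using (∧-monotonic)

  𝟙-greatest : ∀ x → x ≤ 𝟙
  𝟙-greatest = ∧-identityʳ

  𝟘-least : ∀ x → 𝟘 ≤ x
  𝟘-least x = trans (y≤x∨y x 𝟘) (reflexive (∨-identityʳ x))

  IsFilter′ : ∀ {p} → Pred A p → Set (c ⊔ ℓ ⊔ p)
  IsFilter′ = IsFilter _≈_ _∧_ _∨_ 𝟘 𝟙

  IsIdeal′ : ∀ {p} → Pred A p → Set (c ⊔ ℓ ⊔ p)
  IsIdeal′ = IsIdeal _≈_ _∧_ _∨_ 𝟘 𝟙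

  IsPrimeFilter′ : ∀ {p} → Pred A p → Set (c ⊔ ℓ ⊔ p)
  IsPrimeFilter′ = IsPrimeFilter _≈_ _∧_ _∨_ 𝟘 𝟙

  module Filter {p} {Φ : Pred A p} (isFilter : IsFilter′ Φ) where
    open IsFilter isFilter public using (𝟙∈)

    ∈-resp-≤ : ∀ {x y} → x ∈ Φ → x ≤ y → y ∈ Φ
    ∈-resp-≤ = IsFilter.up-closed isFilter _ _

    ∈-resp-≈ : ∀ {x y} → x ≈ y → x ∈ Φ → y ∈ Φ
    ∈-resp-≈ x≈y x∈ = ∈-resp-≤ x∈ (reflexive x≈y)

    ∧-∈ : ∀ {x y} → x ∈ Φ → y ∈ Φ → x ∧ y ∈ Φ
    ∧-∈ = IsFilter.∧-closed isFilter _ _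

  module Ideal {p} {Ι : Pred A p} (isIdeal : IsIdeal′ Ι) where
    open IsIdeal isIdeal public using (𝟘∈)

    ∨-∈ : ∀ {x y} → x ∈ Ι → y ∈ Ι → x ∨ y ∈ Ι
    ∨-∈ = IsIdeal.∨-closed isIdeal _ _

  module PrimeFilter′ {p} {Π : Pred A p} (isPrimeFilter : IsPrimeFilter′ Π) where
    open IsPrimeFilter isPrimeFilter public using (isFilter) renaming (proper to 𝟘∉)
    open Filter isFilter public

    ∨-∈⁻ : ∀ {x y} → x ∨ y ∈ Π → x ∈ Π ⊎ y ∈ Π
    ∨-∈⁻ = IsPrimeFilter.prime isPrimeFilter _ _

    ∁-isIdeal : IsIdeal′ (∁ Π)
    ∁-isIdeal = record
      { 𝟘∈ = 𝟘∉
      ; ∨-closed = λ _ _ x∉ y∉ x∨y∈ → [ x∉ , y∉ ]′ (∨-∈⁻ x∨y∈)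
      ; down-closed = λ _ _ x∉ y≤x y∈ → x∉ (∈-resp-≤ y∈ y≤x)
      }

  ↑_ : A → Pred A (c ⊔ ℓ)
  (↑ a) x = Lift c (a ≤ x)

  ↓_ : A → Pred A (c ⊔ ℓ)
  (↓ a) x = Lift c (x ≤ a)

  ↑-isFilter : ∀ a → IsFilter′ (↑ a)
  ↑-isFilter a = record
    { 𝟙∈ = lift (𝟙-greatest a)
    ; ∧-closed = λ _ _ a≤x a≤y → lift (∧-greatest (lower a≤x) (lower a≤y))
    ; up-closed = λ _ _ a≤x x≤y → lift (trans (lower a≤x) x≤y)
    }

  ↓-isIdeal : ∀ a → IsIdeal′ (↓ a)
  ↓-isIdeal a = record
    { 𝟘∈ = lift (𝟘-least a)
    ; ∨-closed = λ _ _ x≤a y≤a → lift (∨-least (lower x≤a) (lower y≤a))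
    ; down-closed = λ _ _ x≤a y≤x → lift (trans y≤x (lower x≤a))
    }

  infixr 6 _⊔ᶠ_ _⊔ⁱ_

  _⊔ᶠ_ : ∀ {p q} → Pred A p → Pred A q → Pred A (c ⊔ ℓ ⊔ p ⊔ q)
  (Φ ⊔ᶠ Ψ) z = ∃₂ λ x y → x ∈ Φ × y ∈ Ψ × x ∧ y ≤ z

  _⊔ⁱ_ : ∀ {p q} → Pred A p → Pred A q → Pred A (c ⊔ ℓ ⊔ p ⊔ q)
  (Ι ⊔ⁱ Κ) z = ∃₂ λ x y → x ∈ Ι × y ∈ Κ × z ≤ x ∨ y

  module _ {p q} {Φ : Pred A p} {Ψ : Pred A q}
           (isΦ : IsFilter′ Φ) (isΨ : IsFilter′ Ψ) where
    private
      module Φ = Filter isΦ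
      module Ψ = Filter isΨ

    ⊔ᶠ-isFilter : IsFilter′ (Φ ⊔ᶠ Ψ)
    ⊔ᶠ-isFilter = record
      { 𝟙∈ = 𝟙 , 𝟙 , Φ.𝟙∈ , Ψ.𝟙∈ , 𝟙-greatest (𝟙 ∧ 𝟙)
      ; ∧-closed = λ
          { _ _ (x , y , x∈ , y∈ , x∧y≤) (x′ , y′ , x′∈ , y′∈ , x′∧y′≤) →
          x ∧ x′ , y ∧ y′ , Φ.∧-∈ x∈ x′∈ , Ψ.∧-∈ y∈ y′∈ ,
          ∧-greatest (trans (∧-monotonic (x∧y≤x x x′) (x∧y≤x y y′)) x∧y≤)
                     (trans (∧-monotonic (x∧y≤y x x′) (x∧y≤y y y′)) x′∧y′≤) }
      ; up-closed = λ
          { _ _ (x , y , x∈ , y∈ , x∧y≤) ≤z → x , y , x∈ , y∈ , trans x∧y≤ ≤z }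
      }

    ⊆-⊔ᶠˡ : Φ ⊆ Φ ⊔ᶠ Ψ
    ⊆-⊔ᶠˡ {x} x∈ = x , 𝟙 , x∈ , Ψ.𝟙∈ , x∧y≤x x 𝟙

    ⊆-⊔ᶠʳ : Ψ ⊆ Φ ⊔ᶠ Ψ
    ⊆-⊔ᶠʳ {y} y∈ = 𝟙 , y , Φ.𝟙∈ , y∈ , x∧y≤y 𝟙 y

  module _ {p q} {Ι : Pred A p} {Κ : Pred A q}
           (isΙ : IsIdeal′ Ι) (isΚ : IsIdeal′ Κ) where
    private
      module Ι = Ideal isΙ
      module Κ = Ideal isΚ

    ⊔ⁱ-isIdeal : IsIdeal′ (Ι ⊔ⁱ Κ)
    ⊔ⁱ-isIdeal = record
      { 𝟘∈ = 𝟘 , 𝟘 , Ι.𝟘∈ , Κ.𝟘∈ , 𝟘-least (𝟘 ∨ 𝟘)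
      ; ∨-closed = λ
          { _ _ (x , y , x∈ , y∈ , ≤x∨y) (x′ , y′ , x′∈ , y′∈ , ≤x′∨y′) →
          x ∨ x′ , y ∨ y′ , Ι.∨-∈ x∈ x′∈ , Κ.∨-∈ y∈ y′∈ ,
          ∨-least (trans ≤x∨y (∨-monotonic (x≤x∨y x x′) (x≤x∨y y y′)))
                  (trans ≤x′∨y′ (∨-monotonic (y≤x∨y x x′) (y≤x∨y y y′))) }
      ; down-closed = λ
          { _ _ (x , y , x∈ , y∈ , ≤x∨y) z≤ → x , y , x∈ , y∈ , trans z≤ ≤x∨y }
      }

    ⊆-⊔ⁱˡ : Ι ⊆ Ι ⊔ⁱ Κ
    ⊆-⊔ⁱˡ {x} x∈ = x , 𝟘 , x∈ , Κ.𝟘∈ , x≤x∨y x 𝟘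

    ⊆-⊔ⁱʳ : Κ ⊆ Ι ⊔ⁱ Κ
    ⊆-⊔ⁱʳ {y} y∈ = 𝟘 , y , Ι.𝟘∈ , y∈ , y≤x∨y 𝟘 y

  ≤-by-primeFilters : LEM → PrimeFilterTheorem → ∀ {a b} →
    (∀ (Π : Pred A (c ⊔ ℓ)) → IsPrimeFilter′ Π → a ∈ Π → b ∈ Π) → a ≤ b
  ≤-by-primeFilters lem pft {a} {b} a∈⇒b∈ = em⇒dne lem λ a≰b →
    let (Π , isΠ , ↑a⊆Π , Π∩↓b=∅) =
          pft _≈_ _∧_ _∨_ 𝟘 𝟙 bdl (↑ a) (↓ b) (↑-isFilter a) (↓-isIdeal b)
              (λ _ a≤x x≤b → a≰b (trans (lower a≤x) (lower x≤b)))
    in Π∩↓b=∅ b (a∈⇒b∈ Π isΠ (↑a⊆Π (lift ≤-refl))) (lift ≤-refl)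

  module FiniteJoins (lem : LEM) where

    ⋁ ⋀ : ∀ {n} → (Fin n → A) → A
    ⋁ = Vector.foldr _∨_ 𝟘
    ⋀ = Vector.foldr _∧_ 𝟙

    ⋁-upper : ∀ {n} (f : Fin n → A) i → f i ≤ ⋁ f
    ⋁-upper f zero = x≤x∨y _ _
    ⋁-upper f (suc i) = trans (⋁-upper (f ∘ suc) i) (y≤x∨y _ _)

    ⋀-lower : ∀ {n} (f : Fin n → A) i → ⋀ f ≤ f i
    ⋀-lower f zero = x∧y≤x _ _
    ⋀-lower f (suc i) = trans (x∧y≤y _ _) (⋀-lower (f ∘ suc) i)

    module _ {p} {Π : Pred A p} (isΠ : IsPrimeFilter′ Π) where
      open PrimeFilter′ isΠ

      ⋁-∈⁻ : ∀ {n} (f : Fin n → A) → ⋁ f ∈ Π → ∃ λ i → f i ∈ Π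
      ⋁-∈⁻ {zero} f 𝟘∈ = contradiction 𝟘∈ 𝟘∉
      ⋁-∈⁻ {suc n} f ⋁∈ with ∨-∈⁻ ⋁∈
      ... | inj₁ f0∈ = zero , f0∈
      ... | inj₂ rest∈ = let (i , fi∈) = ⋁-∈⁻ (f ∘ suc) rest∈ in suc i , fi∈

    ⋀-∈ : ∀ {p} {Φ : Pred A p} → IsFilter′ Φ →
          ∀ {n} (f : Fin n → A) → (∀ i → f i ∈ Φ) → ⋀ f ∈ Φ
    ⋀-∈ isΦ {zero} f _ = Filter.𝟙∈ isΦ
    ⋀-∈ isΦ {suc n} f all∈ =
      Filter.∧-∈ isΦ (all∈ zero) (⋀-∈ isΦ (f ∘ suc) (all∈ ∘ suc))

    private
      _if_else_ : ∀ {q} {Q : Set q} → A → Dec Q → A → A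
      x if yes _ else y = x
      x if no _ else y = y

      if-holds : ∀ {q} {Q : Set q} (d : Dec Q) {x y} → Q → (x if d else y) ≈ x
      if-holds (yes _) _ = ≈-refl
      if-holds (no ¬q) q = contradiction q ¬q

    ⋁[_]_ ⋀[_]_ : ∀ {n q} → Pred (Fin n) q → (Fin n → A) → A
    ⋁[ Q ] f = ⋁ λ i → f i if lem {P = Q i} else 𝟘
    ⋀[ Q ] f = ⋀ λ i → f i if lem {P = Q i} else 𝟙

    ⋁[]-upper : ∀ {n q} (Q : Pred (Fin n) q) f {i} → Q i → f i ≤ ⋁[ Q ] f
    ⋁[]-upper Q f {i} qi =
      trans (reflexive (≈-sym (if-holds lem qi)))
            (⋁-upper (λ j → f j if lem {P = Q j} else 𝟘) i)

    ⋀[]-lower : ∀ {n q} (Q : Pred (Fin n) q) f {i} → Q i → ⋀[ Q ] f ≤ f i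
    ⋀[]-lower Q f {i} qi =
      trans (⋀-lower (λ j → f j if lem {P = Q j} else 𝟙) i) (reflexive (if-holds lem qi))

    ⋁[]-∈⁻ : ∀ {p} {Π : Pred A p} → IsPrimeFilter′ Π → ∀ {n q} (Q : Pred (Fin n) q) f →
             ⋁[ Q ] f ∈ Π → ∃ λ i → Q i × f i ∈ Π
    ⋁[]-∈⁻ {Π = Π} isΠ Q f ⋁∈ =
      let (i , fi?∈) = ⋁-∈⁻ isΠ _ ⋁∈ in i , kept (lem {P = Q i}) fi?∈
      where
        kept : ∀ {q} {Q : Set q} (d : Dec Q) {x} → (x if d else 𝟘) ∈ Π → Q × x ∈ Π
        kept (yes q) x∈ = q , x∈
        kept (no _) 𝟘∈ = contradiction 𝟘∈ (PrimeFilter′.𝟘∉ isΠ)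

    ⋀[]-∈ : ∀ {p} {Φ : Pred A p} → IsFilter′ Φ → ∀ {n q} (Q : Pred (Fin n) q) f →
            (∀ {i} → Q i → f i ∈ Φ) → ⋀[ Q ] f ∈ Φ
    ⋀[]-∈ {Φ = Φ} isΦ Q f Q⊆ = ⋀-∈ isΦ _ (λ i → kept (lem {P = Q i}) Q⊆)
      where
        kept : ∀ {q} {Q : Set q} (d : Dec Q) {x} →
               (Q → x ∈ Φ) → (x if d else 𝟙) ∈ Φ
        kept (yes q) x∈ = x∈ q
        kept (no _) _ = Filter.𝟙∈ isΦ

    onto⇒join-dense : ∀ {n} (e : Fin n → A) → (∀ y → ∃ λ i → e i ≈ y) →
                      ∀ y → y ≤ ⋁[ (λ i → e i ≤ y) ] e
    onto⇒join-dense e onto y =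
      let (i , ei≈y) = onto y
      in trans (reflexive (≈-sym ei≈y)) (⋁[]-upper _ e (reflexive ei≈y))

    primeFilter-generated-by : ∀ {p} {Π : Pred A p} → IsPrimeFilter′ Π →
      ∀ {n} (g : Fin n → A) → (∀ y → y ≤ ⋁[ (λ i → g i ≤ y) ] g) →
      ∃ λ j → g j ∈ Π × (∀ {y} → y ∈ Π → g j ≤ y)
    primeFilter-generated-by {p} {Π} isΠ {n} g join-dense =
      let (j , gj≤⋀ , gj∈) = below (⋀[]-∈ isFilter Q g (λ gi∈ → gi∈))
      in j , gj∈ , λ y∈ → let (i , gi≤y , gi∈) = below y∈
                          in trans (trans gj≤⋀ (⋀[]-lower Q g gi∈)) gi≤y
      where
        open PrimeFilter′ isΠ
        Q : Pred (Fin n) p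
        Q i = g i ∈ Π
        below : ∀ {y} → y ∈ Π → ∃ λ i → g i ≤ y × g i ∈ Π
        below {y} y∈ = ⋁[]-∈⁻ isΠ _ g (∈-resp-≤ y∈ (join-dense y))

module _ {c ℓ} {A : Set c} (_≈_ : Rel A ℓ) (_∧_ _∨_ : Op₂ A) (𝟘 𝟙 : A) where
  private
    _≤_ : Rel A ℓ
    _≤_ = _≤ᴸ_ _≈_ _∧_ _∨_ 𝟘 𝟙

  record IsPositiveModal (□ ◇ : Op₁ A) : Set (c ⊔ ℓ) where
    field
      □-cong : Congruent₁ _≈_ □
      ◇-cong : Congruent₁ _≈_ ◇
      □-𝟙 : □ 𝟙 ≈ 𝟙
      □-∧ : ∀ x y → □ (x ∧ y) ≈ (□ x ∧ □ y)
      □-∨ : ∀ x y → □ (x ∨ y) ≤ (□ x ∨ ◇ y)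
      ◇-𝟘 : ◇ 𝟘 ≈ 𝟘
      ◇-∨ : ∀ x y → ◇ (x ∨ y) ≈ (◇ x ∨ ◇ y)
      □∧◇ : ∀ x y → (□ x ∧ ◇ y) ≤ ◇ (x ∧ y)

module CanonicalSuccessor
    {c ℓ} (𝒜 : TDLRaw c ℓ) (lem : LEM) (pft : PrimeFilterTheorem)
    (bdl : IsBDL (TDLRaw._≈_ 𝒜) (TDLRaw._∧_ 𝒜) (TDLRaw._∨_ 𝒜)
                 (TDLRaw.𝟘 𝒜) (TDLRaw.𝟙 𝒜))
    {□ ◇ : Op₁ (TDLRaw.Carrier 𝒜)}
    (isPositiveModal : IsPositiveModal (TDLRaw._≈_ 𝒜) (TDLRaw._∧_ 𝒜) (TDLRaw._∨_ 𝒜)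
                                       (TDLRaw.𝟘 𝒜) (TDLRaw.𝟙 𝒜) □ ◇)
    where

  open TDLRaw 𝒜

  open BoundedDistributiveLattice bdl hiding (_≤_)
  open IsPositiveModal isPositiveModal
  open PrimeFilter
  private
    module PF (S : PrimeFilter 𝒜) = PrimeFilter′ (isPrimeFilter S)

  □-mono : ∀ {x y} → x ≤ y → □ x ≤ □ y
  □-mono {x} {y} x∧y≈x = ≈-trans (≈-sym (□-∧ x y)) (□-cong x∧y≈x)

  ◇-mono : ∀ {x y} → x ≤ y → ◇ x ≤ ◇ y
  ◇-mono {x} {y} x≤y =
    trans (x≤x∨y (◇ x) (◇ y))
          (reflexive (≈-trans (≈-sym (◇-∨ x y)) (◇-cong (x≤y⇒x∨y≈y x≤y))))

  □⁻¹[_] ◇⁻¹[_] : PrimeFilter 𝒜 → Pred Carrier (c ⊔ ℓ)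
  □⁻¹[ S ] a = □ a ∈ pf S
  ◇⁻¹[ S ] a = ◇ a ∈ pf S

  infix 4 _↝_
  _↝_ : PrimeFilter 𝒜 → PrimeFilter 𝒜 → Set (c ⊔ ℓ)
  S ↝ T = □⁻¹[ S ] ⊆ pf T × pf T ⊆ ◇⁻¹[ S ]

  □⁻¹-isFilter : ∀ S → IsFilter′ □⁻¹[ S ]
  □⁻¹-isFilter S = record
    { 𝟙∈ = ∈-resp-≈ (≈-sym □-𝟙) 𝟙∈
    ; ∧-closed = λ x y □x∈ □y∈ → ∈-resp-≈ (≈-sym (□-∧ x y)) (∧-∈ □x∈ □y∈)
    ; up-closed = λ _ _ □x∈ x≤y → ∈-resp-≤ □x∈ (□-mono x≤y)
    }
    where open PF S

  ◇⁻¹ᶜ-isIdeal : ∀ S → IsIdeal′ (∁ ◇⁻¹[ S ])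
  ◇⁻¹ᶜ-isIdeal S = record
    { 𝟘∈ = λ ◇𝟘∈ → 𝟘∉ (∈-resp-≈ ◇-𝟘 ◇𝟘∈)
    ; ∨-closed = λ x y ◇x∉ ◇y∉ ◇x∨y∈ →
        [ ◇x∉ , ◇y∉ ]′ (∨-∈⁻ (∈-resp-≈ (◇-∨ x y) ◇x∨y∈))
    ; down-closed = λ _ _ ◇x∉ y≤x ◇y∈ → ◇x∉ (∈-resp-≤ ◇y∈ (◇-mono y≤x))
    }
    where open PF S

  successor-between : ∀ S {Φ Ι : Pred Carrier (c ⊔ ℓ)} →
    IsFilter′ Φ → IsIdeal′ Ι → Disjoint Φ Ι → □⁻¹[ S ] ⊆ Φ → ∁ ◇⁻¹[ S ] ⊆ Ι →
    ∃ λ T → S ↝ T × Φ ⊆ pf T × Disjoint (pf T) Ι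
  successor-between S isΦ isΙ Φ∩Ι=∅ □⁻¹⊆Φ ◇⁻¹ᶜ⊆Ι =
    let (Π , isΠ , Φ⊆Π , Π∩Ι=∅) = pft _≈_ _∧_ _∨_ 𝟘 𝟙 bdl _ _ isΦ isΙ Φ∩Ι=∅
    in record { pf = Π ; isPrimeFilter = isΠ } ,
       ((λ □x∈ → Φ⊆Π (□⁻¹⊆Φ □x∈)) ,
        (λ {x} x∈ → em⇒dne lem λ ◇x∉ → Π∩Ι=∅ x x∈ (◇⁻¹ᶜ⊆Ι ◇x∉))) ,
       Φ⊆Π , Π∩Ι=∅

  successor-containing : ∀ S {Q : Pred Carrier (c ⊔ ℓ)} →
    IsFilter′ Q → Q ⊆ ◇⁻¹[ S ] → ∃ λ T → S ↝ T × Q ⊆ pf T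
  successor-containing S {Q} isQ Q⊆◇⁻¹ =
    let (T , S↝T , Q⊔□⁻¹⊆T , _) =
          successor-between S (⊔ᶠ-isFilter isQ (□⁻¹-isFilter S)) (◇⁻¹ᶜ-isIdeal S)
            disjoint (⊆-⊔ᶠʳ isQ (□⁻¹-isFilter S)) (λ ◇x∉ → ◇x∉)
    in T , S↝T , λ t∈ → Q⊔□⁻¹⊆T (⊆-⊔ᶠˡ isQ (□⁻¹-isFilter S) t∈)
    where
      open PF S
      disjoint : Disjoint (Q ⊔ᶠ □⁻¹[ S ]) (∁ ◇⁻¹[ S ])
      disjoint z (t , b , t∈ , □b∈ , t∧b≤z) ◇z∉ =
        ◇z∉ (∈-resp-≤ (∈-resp-≤ (∧-∈ □b∈ (Q⊆◇⁻¹ t∈)) (□∧◇ b t))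
                      (◇-mono (trans (∧-greatest (x∧y≤y b t) (x∧y≤x b t)) t∧b≤z)))

  successor-avoiding : ∀ S {J : Pred Carrier (c ⊔ ℓ)} →
    IsIdeal′ J → Disjoint □⁻¹[ S ] J → ∃ λ T → S ↝ T × Disjoint (pf T) J
  successor-avoiding S {J} isJ □⁻¹∩J=∅ =
    let (T , S↝T , _ , T∩J⊔◇⁻¹ᶜ=∅) =
          successor-between S (□⁻¹-isFilter S) (⊔ⁱ-isIdeal isJ (◇⁻¹ᶜ-isIdeal S))
            disjoint (λ □x∈ → □x∈) (⊆-⊔ⁱʳ isJ (◇⁻¹ᶜ-isIdeal S))
    in T , S↝T , λ x x∈T x∈J →
         T∩J⊔◇⁻¹ᶜ=∅ x x∈T (⊆-⊔ⁱˡ isJ (◇⁻¹ᶜ-isIdeal S) x∈J)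
    where
      open PF S
      disjoint : Disjoint □⁻¹[ S ] (J ⊔ⁱ ∁ ◇⁻¹[ S ])
      disjoint z □z∈ (d , e , d∈ , ◇e∉ , z≤d∨e) =
        [ (λ □d∈ → □⁻¹∩J=∅ d □d∈ d∈) , ◇e∉ ]′
          (∨-∈⁻ (∈-resp-≤ (∈-resp-≤ □z∈ (□-mono z≤d∨e)) (□-∨ d e)))

  □-∈⇔ : ∀ S a → □ a ∈ pf S ⇔ (∀ T → S ↝ T → a ∈ pf T)
  □-∈⇔ S a = mk⇔ (λ □a∈ T S↝T → proj₁ S↝T □a∈) λ a∈succ →
    em⇒dne lem λ □a∉ →
    let (T , S↝T , T∩↓a=∅) =
          successor-avoiding S (↓-isIdeal a)
            (λ x □x∈ x≤a → □a∉ (PF.∈-resp-≤ S □x∈ (□-mono (lower x≤a))))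
    in T∩↓a=∅ a (a∈succ T S↝T) (lift ≤-refl)

  ◇-∈⇔ : ∀ S a → ◇ a ∈ pf S ⇔ (∃ λ T → S ↝ T × a ∈ pf T)
  ◇-∈⇔ S a = mk⇔
    (λ ◇a∈ →
      let (T , S↝T , ↑a⊆T) =
            successor-containing S (↑-isFilter a)
              (λ a≤x → PF.∈-resp-≤ S ◇a∈ (◇-mono (lower a≤x)))
      in T , S↝T , ↑a⊆T (lift ≤-refl))
    (λ (T , S↝T , a∈T) → proj₂ S↝T a∈T)

  ↝-K1 : ∀ S S′ T → pf S ⊆ pf S′ → S′ ↝ T → ∃ λ T′ → S ↝ T′ × pf T′ ⊆ pf T
  ↝-K1 S S′ T S⊆S′ S′↝T =
    let (T′ , S↝T′ , T′∩∁T=∅) =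
          successor-avoiding S (PF.∁-isIdeal T)
            (λ x □x∈ x∉T → x∉T (proj₁ S′↝T (S⊆S′ □x∈)))
    in T′ , S↝T′ , λ x∈ → em⇒dne lem (T′∩∁T=∅ _ x∈)

  ↝-K3 : ∀ S S′ T → pf S′ ⊆ pf S → S′ ↝ T → ∃ λ T′ → S ↝ T′ × pf T ⊆ pf T′
  ↝-K3 S S′ T S′⊆S S′↝T =
    successor-containing S (PF.isFilter T) (λ x∈ → S′⊆S (proj₂ S′↝T x∈))

module CanonicalFrameProperties
    {c ℓ} (𝒜 : TDLRaw c ℓ) (isTDL : IsTDL 𝒜) (lem : LEM) (pft : PrimeFilterTheorem) where

  open TDLRaw 𝒜
  open IsTDL isTDL
  open BoundedDistributiveLattice isBDL hiding (_≤_)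
  open PrimeFilter
  private
    module PF (S : PrimeFilter 𝒜) = PrimeFilter′ (isPrimeFilter S)

  G-F-isPositiveModal : IsPositiveModal _≈_ _∧_ _∨_ 𝟘 𝟙 G F
  G-F-isPositiveModal = record
    { □-cong = G-cong ; ◇-cong = F-cong ; □-𝟙 = G𝟙 ; □-∧ = G-∧ ; □-∨ = G-∨
    ; ◇-𝟘 = F𝟘 ; ◇-∨ = F-∨ ; □∧◇ = G∧F }

  H-P-isPositiveModal : IsPositiveModal _≈_ _∧_ _∨_ 𝟘 𝟙 H P
  H-P-isPositiveModal = record
    { □-cong = H-cong ; ◇-cong = P-cong ; □-𝟙 = H𝟙 ; □-∧ = H-∧ ; □-∨ = H-∨
    ; ◇-𝟘 = P𝟘 ; ◇-∨ = P-∨ ; □∧◇ = H∧P }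

  module GF = CanonicalSuccessor 𝒜 lem pft isBDL G-F-isPositiveModal
  module HP = CanonicalSuccessor 𝒜 lem pft isBDL H-P-isPositiveModal

  GF↝⇒HP↜ : ∀ S T → S GF.↝ T → T HP.↝ S
  GF↝⇒HP↜ S T (G⁻¹S⊆T , T⊆F⁻¹S) =
    (λ {x} Hx∈T → PF.∈-resp-≤ S (T⊆F⁻¹S Hx∈T) (FHx≤x x)) ,
    (λ {x} x∈S → G⁻¹S⊆T (PF.∈-resp-≤ S x∈S (x≤GPx x)))

  HP↜⇒GF↝ : ∀ S T → T HP.↝ S → S GF.↝ T
  HP↜⇒GF↝ S T (H⁻¹T⊆S , S⊆P⁻¹T) =
    (λ {x} Gx∈S → PF.∈-resp-≤ T (S⊆P⁻¹T Gx∈S) (PGx≤x x)) ,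
    (λ {x} x∈T → H⁻¹T⊆S (PF.∈-resp-≤ T x∈T (x≤HFx x)))

  canonicalFrame-isTDLFrame : IsTDLFrame (CanonicalFrame 𝒜)
  canonicalFrame-isTDLFrame = record
    { isPartialOrder = On.isPartialOrder pf ⊆-isPartialOrder
    ; K1 = λ { S {T} (S′ , S⊆S′ , S′↝T) → GF.↝-K1 S S′ T S⊆S′ S′↝T }
    ; K2 = λ { S {T} (S′ , S⊆S′ , T↝S′) →
        let (T′ , S↜T′ , T′⊆T) = HP.↝-K1 S S′ T S⊆S′ (GF↝⇒HP↜ T S′ T↝S′)
        in T′ , HP↜⇒GF↝ T′ S S↜T′ , T′⊆T }
    ; K3 = λ { S {T} (S′ , S′⊆S , S′↝T) → GF.↝-K3 S S′ T S′⊆S S′↝T }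
    ; K4 = λ { S {T} (S′ , S′⊆S , T↝S′) →
        let (T′ , S↜T′ , T⊆T′) = HP.↝-K3 S S′ T S′⊆S (GF↝⇒HP↜ T S′ T↝S′)
        in T′ , HP↜⇒GF↝ T′ S S↜T′ , T⊆T′ }
    ; K5 = λ S →
        (λ {T} S↝T → (T , S↝T , λ x∈ → x∈) , (T , S↝T , λ x∈ → x∈)) ,
        (λ { ((T₁ , (G⁻¹S⊆T₁ , _) , T₁⊆T) , (T₂ , (_ , T₂⊆F⁻¹S) , T⊆T₂)) →
               (λ Gx∈ → T₁⊆T (G⁻¹S⊆T₁ Gx∈)) ,
               (λ x∈ → T₂⊆F⁻¹S (T⊆T₂ x∈)) })
    }

  module _ (isF : IsTDLFrame (CanonicalFrame 𝒜)) where
    private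
      ℭ : TDLRaw (lsuc (upℓ (CanonicalFrame 𝒜))) (upℓ (CanonicalFrame 𝒜))
      ℭ = ComplexAlgebra (CanonicalFrame 𝒜) isF
      module ℭ = TDLRaw ℭ
      open Equivalence

    h-isTDLHomomorphism : IsTDLHomomorphism 𝒜 ℭ (h 𝒜)
    h-isTDLHomomorphism = record
      { cong = λ x≈y → (λ {T} x∈ → lift (PF.∈-resp-≈ T x≈y (lower x∈))) ,
                       (λ {T} y∈ → lift (PF.∈-resp-≈ T (≈-sym x≈y) (lower y∈)))
      ; ∧-homo = λ x y →
          (λ {T} x∧y∈ → lift (PF.∈-resp-≤ T (lower x∧y∈) (x∧y≤x x y)) ,
                        lift (PF.∈-resp-≤ T (lower x∧y∈) (x∧y≤y x y))) ,
          (λ {T} (x∈ , y∈) → lift (PF.∧-∈ T (lower x∈) (lower y∈)))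
      ; ∨-homo = λ x y →
          (λ {T} x∨y∈ → Sum.map lift lift (PF.∨-∈⁻ T (lower x∨y∈))) ,
          (λ { {T} (inj₁ x∈) → lift (PF.∈-resp-≤ T (lower x∈) (x≤x∨y x y))
             ; {T} (inj₂ y∈) → lift (PF.∈-resp-≤ T (lower y∈) (y≤x∨y x y)) })
      ; 𝟘-homo = (λ {T} 𝟘∈ → contradiction (lower 𝟘∈) (PF.𝟘∉ T)) , λ ()
      ; 𝟙-homo = (λ _ → lift _) , (λ {T} _ → lift (PF.𝟙∈ T))
      ; G-homo = λ x →
          (λ {T} Gx∈ S T↝S → lift (to (GF.□-∈⇔ T x) (lower Gx∈) S T↝S)) ,
          (λ {T} x∈succ → lift (from (GF.□-∈⇔ T x) λ S T↝S → lower (x∈succ S T↝S)))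
      ; H-homo = λ x →
          (λ {T} Hx∈ S S↝T → lift (to (HP.□-∈⇔ T x) (lower Hx∈) S (GF↝⇒HP↜ S T S↝T))) ,
          (λ {T} x∈pred →
             lift (from (HP.□-∈⇔ T x) λ S T↜S → lower (x∈pred S (HP↜⇒GF↝ S T T↜S))))
      ; F-homo = λ x →
          (λ {T} Fx∈ → let (S , T↝S , x∈S) = to (GF.◇-∈⇔ T x) (lower Fx∈)
                       in S , T↝S , lift x∈S) ,
          (λ {T} (S , T↝S , x∈S) → lift (from (GF.◇-∈⇔ T x) (S , T↝S , lower x∈S)))
      ; P-homo = λ x →
          (λ {T} Px∈ → let (S , T↜S , x∈S) = to (HP.◇-∈⇔ T x) (lower Px∈)
                       in S , HP↜⇒GF↝ S T T↜S , lift x∈S) ,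
          (λ {T} (S , S↝T , x∈S) →
             lift (from (HP.◇-∈⇔ T x) (S , GF↝⇒HP↜ S T S↝T , lower x∈S)))
      }

    h-injective : ∀ {x y} → h 𝒜 x ℭ.≈ h 𝒜 y → x ≈ y
    h-injective (hx⊆hy , hy⊆hx) = antisym
      (≤-by-primeFilters lem pft λ Π isΠ x∈ → lower (hx⊆hy {primeFilter Π isΠ} (lift x∈)))
      (≤-by-primeFilters lem pft λ Π isΠ y∈ → lower (hy⊆hx {primeFilter Π isΠ} (lift y∈)))
      where
        primeFilter : ∀ Π → IsPrimeFilter′ Π → PrimeFilter 𝒜
        primeFilter Π isΠ = record { pf = Π ; isPrimeFilter = isΠ }

    h-surjective : Finite _≈_ → ∀ U → ∃ λ a → h 𝒜 a ℭ.≈ U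
    h-surjective (n , e , onto) U =
      a , (λ {T} a∈ → a∈⇒∈U T (lower a∈)) , (λ {T} T∈U → lift (∈U⇒a∈ T T∈U))
      where
        open FiniteJoins lem
        Q : Pred (Fin n) (lsuc (c ⊔ ℓ))
        Q i = ∀ T → e i ∈ pf T → T ∈ set U

        a : Carrier
        a = ⋁[ Q ] e

        a∈⇒∈U : ∀ T → a ∈ pf T → T ∈ set U
        a∈⇒∈U T a∈ =
          let (i , qi , ei∈) = ⋁[]-∈⁻ (isPrimeFilter T) Q e a∈ in qi T ei∈

        ∈U⇒a∈ : ∀ T → T ∈ set U → a ∈ pf T
        ∈U⇒a∈ T T∈U =
          let (j , ej∈ , ej≤) =
                primeFilter-generated-by (isPrimeFilter T) e (onto⇒join-dense e onto)
          in PF.∈-resp-≤ T ej∈ (⋁[]-upper Q e λ T′ ej∈T′ →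
               up U (λ y∈T → PF.∈-resp-≤ T′ ej∈T′ (ej≤ y∈T)) T∈U)

    h-isTDLEmbedding : IsTDLEmbedding 𝒜 ℭ (h 𝒜)
    h-isTDLEmbedding = record
      { isHomomorphism = h-isTDLHomomorphism ; injective = h-injective }

    h-isTDLIsomorphism : Finite _≈_ → IsTDLIsomorphism 𝒜 ℭ (h 𝒜)
    h-isTDLIsomorphism finite = record
      { isEmbedding = h-isTDLEmbedding ; surjective = h-surjective finite }

module _ {a} {X : Set a} {p q} {Y : Pred X p} {Z : Pred X q} where

  ⊆⇒∩≐ : Y ⊆ Z → Y ∩ Z ≐ Y
  ⊆⇒∩≐ Y⊆Z = proj₁ , λ y∈ → y∈ , Y⊆Z y∈

  ∩≐⇒⊆ : Y ∩ Z ≐ Y → Y ⊆ Z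
  ∩≐⇒⊆ (_ , Y⊆Y∩Z) y∈ = proj₂ (Y⊆Y∩Z y∈)

module _ {a} {X : Set a} where

  infix 9 [_]_ ⟨_⟩_

  [_]_ : ∀ {ρ p} → Rel X ρ → Pred X p → Pred X (a ⊔ ρ ⊔ p)
  ([ S ] Y) x = ∀ y → S x y → y ∈ Y

  ⟨_⟩_ : ∀ {ρ p} → Rel X ρ → Pred X p → Pred X (a ⊔ ρ ⊔ p)
  (⟨ S ⟩ Y) x = ∃ λ y → S x y × y ∈ Y

  module _ {ρ} {S : Rel X ρ} {p q} {Y : Pred X p} {Z : Pred X q} where

    []-mono : Y ⊆ Z → [ S ] Y ⊆ [ S ] Z
    []-mono Y⊆Z □Y y Sxy = Y⊆Z (□Y y Sxy)

    ⟨⟩-mono : Y ⊆ Z → ⟨ S ⟩ Y ⊆ ⟨ S ⟩ Z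
    ⟨⟩-mono Y⊆Z (y , Sxy , y∈) = y , Sxy , Y⊆Z y∈

    []-∩ : [ S ] (Y ∩ Z) ≐ [ S ] Y ∩ [ S ] Z
    []-∩ = (λ □Y∩Z → (λ y Sxy → proj₁ (□Y∩Z y Sxy)) ,
                     (λ y Sxy → proj₂ (□Y∩Z y Sxy))) ,
           (λ (□Y , □Z) y Sxy → □Y y Sxy , □Z y Sxy)

    ⟨⟩-∪ : ⟨ S ⟩ (Y ∪ Z) ≐ ⟨ S ⟩ Y ∪ ⟨ S ⟩ Z
    ⟨⟩-∪ = (λ (y , Sxy , y∈) → Sum.map (λ y∈Y → y , Sxy , y∈Y) (λ y∈Z → y , Sxy , y∈Z) y∈) ,
           [ (λ (y , Sxy , y∈Y) → y , Sxy , inj₁ y∈Y) ,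
             (λ (y , Sxy , y∈Z) → y , Sxy , inj₂ y∈Z) ]′

    []-∪ : LEM → [ S ] (Y ∪ Z) ⊆ [ S ] Y ∪ ⟨ S ⟩ Z
    []-∪ lem {x} □Y∪Z with lem {P = (⟨ S ⟩ Z) x}
    ... | yes ◇Z = inj₂ ◇Z
    ... | no ¬◇Z = inj₁ λ y Sxy →
      [ (λ y∈Y → y∈Y) , (λ y∈Z → contradiction (y , Sxy , y∈Z) ¬◇Z) ]′ (□Y∪Z y Sxy)

    []∩⟨⟩ : [ S ] Y ∩ ⟨ S ⟩ Z ⊆ ⟨ S ⟩ (Y ∩ Z)
    []∩⟨⟩ (□Y , (y , Sxy , y∈Z)) = y , Sxy , □Y y Sxy , y∈Z

  module _ {ρ} {S : Rel X ρ} {p} {Y : Pred X p} where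

    ⊆-[]⟨⟩ : Y ⊆ [ S ] ⟨ flip S ⟩ Y
    ⊆-[]⟨⟩ {x} x∈ y Sxy = x , Sxy , x∈

    ⟨⟩[]-⊆ : ⟨ flip S ⟩ [ S ] Y ⊆ Y
    ⟨⟩[]-⊆ {x} (y , Syx , □Y) = □Y x Syx

module ComplexAlgebraProperties
    {x e r ρ} (𝐗 : FrameRaw x e r ρ) (isF : IsTDLFrame 𝐗) (lem : LEM) where

  open FrameRaw 𝐗
  open IsTDLFrame isF
  private
    ℭ : TDLRaw (lsuc (upℓ 𝐗)) (upℓ 𝐗)
    ℭ = ComplexAlgebra 𝐗 isF
    module ℭ = TDLRaw ℭ
    module ≤ = IsPartialOrder isPartialOrder
    module ≈ˣ = IsEquivalence ≤.isEquivalence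

  complexAlgebra-isBDL : IsBDL ℭ._≈_ ℭ._∧_ ℭ._∨_ ℭ.𝟘 ℭ.𝟙
  complexAlgebra-isBDL = record
    { isDistributiveLattice =
        LatticeMonomorphism.isDistributiveLattice set-isLatticeMonomorphism
          (∪-∩-isDistributiveLattice Carrier (upℓ 𝐗))
    ; ∨-identityʳ = λ Y → ∪-identityʳ (set Y)
    ; ∧-identityʳ = λ Y → ∩-identityʳ (set Y)
    }
    where
      set-isLatticeMonomorphism :
        IsLatticeMonomorphism
          (record { _≈_ = ℭ._≈_ ; _∧_ = ℭ._∧_ ; _∨_ = ℭ._∨_ })
          (record { _≈_ = _≐_ ; _∧_ = _∩_ ; _∨_ = _∪_ }) set
      set-isLatticeMonomorphism = record
        { isLatticeHomomorphism = record
          { isRelHomomorphism = record { cong = λ Y≐Z → Y≐Z }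
          ; ∧-homo = λ Y Z → ≐-refl
          ; ∨-homo = λ Y Z → ≐-refl
          }
        ; injective = λ Y≐Z → Y≐Z
        }

  complexAlgebra-isTDL : IsTDL ℭ
  complexAlgebra-isTDL = record
    { isBDL = complexAlgebra-isBDL
    ; G-cong = λ (Y⊆Z , Z⊆Y) → []-mono {S = R} Y⊆Z , []-mono {S = R} Z⊆Y
    ; H-cong = λ (Y⊆Z , Z⊆Y) → []-mono {S = flip R} Y⊆Z , []-mono {S = flip R} Z⊆Y
    ; F-cong = λ (Y⊆Z , Z⊆Y) → ⟨⟩-mono {S = R} Y⊆Z , ⟨⟩-mono {S = R} Z⊆Y
    ; P-cong = λ (Y⊆Z , Z⊆Y) → ⟨⟩-mono {S = flip R} Y⊆Z , ⟨⟩-mono {S = flip R} Z⊆Y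
    ; G𝟙 = (λ _ → _) , (λ _ _ _ → _)
    ; H𝟙 = (λ _ → _) , (λ _ _ _ → _)
    ; G-∧ = λ _ _ → []-∩ {S = R}
    ; H-∧ = λ _ _ → []-∩ {S = flip R}
    ; x≤GPx = λ _ → ⊆⇒∩≐ (⊆-[]⟨⟩ {S = R})
    ; x≤HFx = λ _ → ⊆⇒∩≐ (⊆-[]⟨⟩ {S = flip R})
    ; G-∨ = λ _ _ → ⊆⇒∩≐ ([]-∪ {S = R} lem)
    ; H-∨ = λ _ _ → ⊆⇒∩≐ ([]-∪ {S = flip R} lem)
    ; F𝟘 = (λ ()) , λ ()
    ; P𝟘 = (λ ()) , λ ()
    ; F-∨ = λ _ _ → ⟨⟩-∪ {S = R}
    ; P-∨ = λ _ _ → ⟨⟩-∪ {S = flip R}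
    ; PGx≤x = λ _ → ⊆⇒∩≐ (⟨⟩[]-⊆ {S = R})
    ; FHx≤x = λ _ → ⊆⇒∩≐ (⟨⟩[]-⊆ {S = flip R})
    ; G∧F = λ _ _ → ⊆⇒∩≐ ([]∩⟨⟩ {S = R})
    ; H∧P = λ _ _ → ⊆⇒∩≐ ([]∩⟨⟩ {S = flip R})
    }

  ↑ᵘ_ : Carrier → UpSet 𝐗
  ↑ᵘ a = record
    { set = λ z → Lift (upℓ 𝐗) (a ≤ z)
    ; up = λ y≤z a≤y → lift (≤.trans (lower a≤y) y≤z) }

  ↑R⟨_⟩ : Carrier → UpSet 𝐗
  ↑R⟨ a ⟩ = record
    { set = ↑[ R⟨ a ⟩ ]
    ; up = λ y≤z (w , Raw , w≤y) → w , Raw , ≤.trans w≤y y≤z }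

  private
    𝔐ℭ : FrameRaw (lsuc (lsuc (upℓ 𝐗))) (lsuc (upℓ 𝐗)) (lsuc (upℓ 𝐗)) (lsuc (upℓ 𝐗))
    𝔐ℭ = CanonicalFrame ℭ
    module 𝔐ℭ = FrameRaw 𝔐ℭ

  k-reflects-≤ : ∀ a b → k 𝐗 isF a 𝔐ℭ.≤ k 𝐗 isF b → a ≤ b
  k-reflects-≤ a b ka⊆kb = lower (lower (ka⊆kb {↑ᵘ a} (lift (lift ≤.refl))))

  -- b ∈ ↑R(a) because a ∈ G(↑R(a)), and b ∈ ↓R(a) because a ∈ F(↑b); then K5
  k-reflects-R : ∀ a b → 𝔐ℭ.R (k 𝐗 isF a) (k 𝐗 isF b) → R a b
  k-reflects-R a b (G⁻¹⊆ , ⊆F⁻¹) =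
    let b∈↑R = lower (G⁻¹⊆ {↑R⟨ a ⟩} (lift λ w Raw → w , Raw , ≤.refl))
        (w , Raw , b≤w) = lower (⊆F⁻¹ {↑ᵘ b} (lift (lift ≤.refl)))
    in proj₂ (K5 a) (b∈↑R , w , Raw , lower b≤w)

  k-isFrameEmbedding : IsFrameEmbedding 𝐗 𝔐ℭ (k 𝐗 isF)
  k-isFrameEmbedding = record
    { order-embedding = λ a b →
        mk⇔ (λ a≤b {Y} a∈Y → lift (up Y a≤b (lower a∈Y))) (k-reflects-≤ a b)
    ; relation-embedding = λ a b → mk⇔
        (λ Rab → (λ {Y} Ga∈ → lift (lower Ga∈ b Rab)) ,
                 (λ {Y} b∈Y → lift (b , Rab , lower b∈Y)))
        (k-reflects-R a b)
    }

  k-surjective : Finite _≈_ → ∀ T → ∃ λ a → k 𝐗 isF a 𝔐ℭ.≈ T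
  k-surjective (n , e , onto) T =
    let (j , ↑ej∈ , ↑ej≤) = primeFilter-generated-by isPrimeFilter (↑ᵘ_ ∘ e) join-dense
    in e j ,
       (λ {Y} ej∈Y →
          ∈-resp-≤ {↑ᵘ e j} {Y} ↑ej∈ (⊆⇒∩≐ λ ej≤z → up Y (lower ej≤z) (lower ej∈Y))) ,
       (λ Y∈T → lift (∩≐⇒⊆ (↑ej≤ Y∈T) (lift ≤.refl)))
    where
      open BoundedDistributiveLattice complexAlgebra-isBDL
        using (module FiniteJoins; module PrimeFilter′)
      open FiniteJoins lem
      open PrimeFilter T using (isPrimeFilter)
      open PrimeFilter′ isPrimeFilter using (∈-resp-≤)
      join-dense : ∀ Y → Y ℭ.≤ ⋁[ (λ i → ↑ᵘ e i ℭ.≤ Y) ] (↑ᵘ_ ∘ e)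
      join-dense Y = ⊆⇒∩≐ λ {z} z∈Y →
        let (i , ei≈z) = onto z
            ei∈Y = up Y (≤.reflexive (≈ˣ.sym ei≈z)) z∈Y
            ↑ei≤Y = ⊆⇒∩≐ λ ei≤w → up Y (lower ei≤w) ei∈Y
        in ∩≐⇒⊆ (⋁[]-upper _ (↑ᵘ_ ∘ e) ↑ei≤Y) (lift (≤.reflexive ei≈z))

  k-isFrameIsomorphism : Finite _≈_ → IsFrameIsomorphism 𝐗 𝔐ℭ (k 𝐗 isF)
  k-isFrameIsomorphism finite = record
    { isEmbedding = k-isFrameEmbedding
    ; injective = λ {a} {b} ka≈kb →
        ≤.antisym (k-reflects-≤ a b λ {Y} → proj₁ ka≈kb {Y})
                  (k-reflects-≤ b a λ {Y} → proj₂ ka≈kb {Y})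
    ; surjective = k-surjective finite
    }

theorem5p14 :
  ∀ {c ℓ x e r ρ} → LEM → PrimeFilterTheorem →
  (∀ (𝒜 : TDLRaw c ℓ) → IsTDL 𝒜 →
    IsTDLFrame (CanonicalFrame 𝒜)
    × (∀ (isF : IsTDLFrame (CanonicalFrame 𝒜)) →
        IsTDLEmbedding 𝒜 (ComplexAlgebra (CanonicalFrame 𝒜) isF) (h 𝒜)
        × (Finite (TDLRaw._≈_ 𝒜) →
            IsTDLIsomorphism 𝒜 (ComplexAlgebra (CanonicalFrame 𝒜) isF) (h 𝒜))))
  × (∀ (𝐗 : FrameRaw x e r ρ) (isF : IsTDLFrame 𝐗) →
    IsTDL (ComplexAlgebra 𝐗 isF)
    × IsFrameEmbedding 𝐗 (CanonicalFrame (ComplexAlgebra 𝐗 isF)) (k 𝐗 isF)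
    × (Finite (FrameRaw._≈_ 𝐗) →
        IsFrameIsomorphism 𝐗 (CanonicalFrame (ComplexAlgebra 𝐗 isF)) (k 𝐗 isF)))
theorem5p14 lem pft =
  (λ 𝒜 isTDL →
    let open CanonicalFrameProperties 𝒜 isTDL lem pft
    in canonicalFrame-isTDLFrame ,
       λ isF → h-isTDLEmbedding isF , h-isTDLIsomorphism isF) ,
  (λ 𝐗 isF →
    let open ComplexAlgebraProperties 𝐗 isF lem
    in complexAlgebra-isTDL , k-isFrameEmbedding , k-isFrameIsomorphism)
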